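{- For all positive integers $n$ and $r$, $$\sum_{k=0}^{n-1}S_k^{(2r)}\equiv 0\pmod{n^2},$$ where for a nonnegative integer $m$ and positive integer $s$, $S_m^{(s)}=\sum_{k=0}^{m}\binom{m}{k}^2\binom{2k}{k}(2k+1)^{s}$. -}

module Defs where

open import Data.Nat using (ℕ; zero; suc; _+_; _*_; _^_)
open import Data.Nat.Combinatorics using (_C_)

sumTo : ℕ → (ℕ → ℕ) → ℕ
sumTo zero    f = f 0
sumTo (suc m) f = sumTo m f + f (suc m)

sumBelow : ℕ → (ℕ → ℕ) → ℕ
sumBelow zero    f = 0
sumBelow (suc n) f = sumBelow n f + f n

S : ℕ → ℕ → ℕ
S m s = sumTo m (λ k → (m C k) * (m C k) * ((2 * k) C k) * (2 * k + 1) ^ s)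

{-# OPTIONS --safe #-}
module Submission where

-- Write X(n,k) = (2k+1) C(2k,k) C(n,k)², so that S_n^(s+1) = Σ_k (2k+1)^s X(n,k), and put
-- O_s(m) = Σ_{i<m} (2i+1)^s and T(n,k) = C(n,k+1)² C(2k+1,k) (3(k+1) - 2n).
-- Pascal's rule and absorption give T(n+1,k) - T(n,k) = X(n,k) - X(n,k+1), so summation by
-- parts and induction on n yield  Σ_{j<n} S_j^(s+1) = Σ_{k<n} O_s(k+1) T(n,k).
-- For odd s, m ∣ O_s(m) by pairing i with m-1-i, while (k+1) C(n,k+1) = n C(n-1,k) makes
-- (k+1) T(n,k) a multiple of n²; hence n² divides every term on the right.

open import Defs
open import Data.Nat as ℕ using (ℕ; zero; suc; NonZero; ≢-nonZero⁻¹)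
import Data.Nat.Properties as ℕ
import Data.Nat.Divisibility as ℕ
open import Data.Nat.Combinatorics using (_C_; k>n⇒nCk≡0; nCk+nC[k+1]≡[n+1]C[k+1]; nCk≡nC[n∸k]; nC1≡n)
import Data.Integer.Properties as ℤ
open import Data.Empty using (⊥-elim)
open import Relation.Binary.PropositionalEquality
open ≡-Reasoning

module _ where

  open import Data.Nat using (_+_; _*_; _^_; _∸_; _<_; s≤s; z≤n)
  open import Data.Nat.Divisibility using (_∣_; divides; ∣m∣n⇒∣m+n; ∣m+n∣m⇒∣n; *-cancelˡ-∣; ∣-trans; m∣m*n; n∣m*n; ∣-reflexive)
  open import Data.Nat.Tactic.RingSolver using (solve-∀)
  open import Algebra.Properties.CommutativeSemigroup ℕ.+-commutativeSemigroup using (interchange)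

  sumTo≡sumBelow : ∀ m f → sumTo m f ≡ sumBelow (suc m) f
  sumTo≡sumBelow zero    f = refl
  sumTo≡sumBelow (suc m) f = cong (_+ f (suc m)) (sumTo≡sumBelow m f)

  sumBelow-cong : ∀ m {f g : ℕ → ℕ} → (∀ i → f i ≡ g i) → sumBelow m f ≡ sumBelow m g
  sumBelow-cong zero    f≗g = refl
  sumBelow-cong (suc m) f≗g = cong₂ _+_ (sumBelow-cong m f≗g) (f≗g m)

  sumBelow-+ : ∀ m (f g : ℕ → ℕ) → sumBelow m (λ i → f i + g i) ≡ sumBelow m f + sumBelow m g
  sumBelow-+ zero    f g = refl
  sumBelow-+ (suc m) f g = begin
    sumBelow m (λ i → f i + g i) + (f m + g m)   ≡⟨ cong (_+ (f m + g m)) (sumBelow-+ m f g) ⟩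
    sumBelow m f + sumBelow m g + (f m + g m)    ≡⟨ interchange (sumBelow m f) (sumBelow m g) (f m) (g m) ⟩
    sumBelow m f + f m + (sumBelow m g + g m)    ∎

  sumBelow-suc : ∀ m (f : ℕ → ℕ) → sumBelow (suc m) f ≡ f 0 + sumBelow m (λ i → f (suc i))
  sumBelow-suc zero    f = ℕ.+-comm 0 (f 0)
  sumBelow-suc (suc m) f = trans (cong (_+ f (suc m)) (sumBelow-suc m f)) (ℕ.+-assoc (f 0) _ _)

  sumBelow-reverse : ∀ m (f : ℕ → ℕ) → sumBelow m f ≡ sumBelow m (λ i → f (m ∸ suc i))
  sumBelow-reverse zero    f = refl
  sumBelow-reverse (suc m) f = begin
    sumBelow m f + f m                          ≡⟨ ℕ.+-comm (sumBelow m f) (f m) ⟩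
    f m + sumBelow m f                          ≡⟨ cong (f m +_) (sumBelow-reverse m f) ⟩
    f m + sumBelow m (λ i → f (m ∸ suc i))      ≡⟨ sumBelow-suc m (λ i → f (m ∸ i)) ⟨
    sumBelow (suc m) (λ i → f (suc m ∸ suc i))  ∎

  ∣-sumBelow : ∀ {d} m {f : ℕ → ℕ} → (∀ i → i < m → d ∣ f i) → d ∣ sumBelow m f
  ∣-sumBelow zero    d∣f = divides 0 refl
  ∣-sumBelow (suc m) d∣f = ∣m∣n⇒∣m+n (∣-sumBelow m (λ i i<m → d∣f i (ℕ.m<n⇒m<1+n i<m))) (d∣f m (ℕ.n<1+n m))

  m+n∣m^[1+2t]+n^[1+2t] : ∀ t m n → m + n ∣ m ^ suc (2 * t) + n ^ suc (2 * t)
  m+n∣m^[1+2t]+n^[1+2t] zero    m n = ∣-reflexive (sym (cong₂ _+_ (ℕ.^-identityʳ m) (ℕ.^-identityʳ n)))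
  m+n∣m^[1+2t]+n^[1+2t] (suc t) m n =
    subst (λ e → m + n ∣ m ^ suc e + n ^ suc e) (sym (ℕ.*-distribˡ-+ 2 1 t)) m+n∣m²u+n²v
    where
    u = m ^ suc (2 * t)
    v = n ^ suc (2 * t)
    expand : ∀ m n u v → (m + n) * (m * u + n * v) ≡ m * n * (u + v) + (m * (m * u) + n * (n * v))
    expand = solve-∀
    m+n∣m²u+n²v : m + n ∣ m * (m * u) + n * (n * v)
    m+n∣m²u+n²v = ∣m+n∣m⇒∣n (subst (m + n ∣_) (expand m n u v) (m∣m*n _))
                            (∣-trans (m+n∣m^[1+2t]+n^[1+2t] t m n) (n∣m*n (m * n)))

  oddPower : ℕ → ℕ → ℕ
  oddPower s i = (2 * i + 1) ^ s

  oddPowerSum : ℕ → ℕ → ℕ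
  oddPowerSum s m = sumBelow m (oddPower s)

  m∣oddPowerSum[1+2t] : ∀ t m → m ∣ oddPowerSum (suc (2 * t)) m
  m∣oddPowerSum[1+2t] t m = *-cancelˡ-∣ 2 (subst (2 * m ∣_) paired≡double 2m∣paired)
    where
    f : ℕ → ℕ
    f = oddPower (suc (2 * t))
    odd+odd : ∀ i j → (2 * i + 1) + (2 * j + 1) ≡ 2 * (suc i + j)
    odd+odd = solve-∀
    2m∣paired : 2 * m ∣ sumBelow m (λ i → f i + f (m ∸ suc i))
    2m∣paired = ∣-sumBelow m λ i i<m →
      subst (_∣ f i + f (m ∸ suc i))
            (trans (odd+odd i (m ∸ suc i)) (cong (2 *_) (ℕ.m+[n∸m]≡n i<m)))
            (m+n∣m^[1+2t]+n^[1+2t] t (2 * i + 1) (2 * (m ∸ suc i) + 1))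
    paired≡double : sumBelow m (λ i → f i + f (m ∸ suc i)) ≡ 2 * oddPowerSum (suc (2 * t)) m
    paired≡double = begin
      sumBelow m (λ i → f i + f (m ∸ suc i))                ≡⟨ sumBelow-+ m f (λ i → f (m ∸ suc i)) ⟩
      sumBelow m f + sumBelow m (λ i → f (m ∸ suc i))       ≡⟨ cong (sumBelow m f +_) (sumBelow-reverse m f) ⟨
      sumBelow m f + sumBelow m f                           ≡⟨ cong (sumBelow m f +_) (ℕ.+-identityʳ _) ⟨
      2 * sumBelow m f                                      ∎

  [1+k]*[1+n]C[1+k]≡[1+n]*nCk : ∀ n k → suc k * (suc n C suc k) ≡ suc n * (n C k)
  [1+k]*[1+n]C[1+k]≡[1+n]*nCk zero    zero    = refl
  [1+k]*[1+n]C[1+k]≡[1+n]*nCk zero    (suc k)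
    rewrite k>n⇒nCk≡0 {1} {suc (suc k)} (s≤s (s≤s z≤n)) | k>n⇒nCk≡0 {0} {suc k} (s≤s z≤n) = ℕ.*-zeroʳ (suc (suc k))
  [1+k]*[1+n]C[1+k]≡[1+n]*nCk (suc n) zero
    rewrite nC1≡n (suc (suc n)) = ℕ.*-comm 1 (suc (suc n))
  [1+k]*[1+n]C[1+k]≡[1+n]*nCk (suc n) (suc k) = begin
    suc (suc k) * (suc (suc n) C suc (suc k))                    ≡⟨ cong (suc (suc k) *_) (pascal (suc n) (suc k)) ⟨
    suc (suc k) * (x + y)                                        ≡⟨ regroup (suc k) x y ⟩
    (x + suc k * x) + suc (suc k) * y                            ≡⟨ cong₂ (λ p q → (x + p) + q) ([1+k]*[1+n]C[1+k]≡[1+n]*nCk n k)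
                                                                                                 ([1+k]*[1+n]C[1+k]≡[1+n]*nCk n (suc k)) ⟩
    (x + suc n * (n C k)) + suc n * (n C suc k)                  ≡⟨ ungroup x (suc n) (n C k) (n C suc k) ⟩
    x + suc n * (n C k + n C suc k)                              ≡⟨ cong (λ p → x + suc n * p) (pascal n k) ⟩
    suc (suc n) * x                                              ∎
    where
    pascal = nCk+nC[k+1]≡[n+1]C[k+1]
    x = suc n C suc k
    y = suc n C suc (suc k)
    regroup : ∀ k x y → suc k * (x + y) ≡ (x + k * x) + suc k * y
    regroup = solve-∀
    ungroup : ∀ x m y z → (x + m * y) + m * z ≡ x + m * (y + z)
    ungroup = solve-∀

  [1+2k]Ck : ℕ → ℕ
  [1+2k]Ck k = suc (2 * k) C k

  [1+2k]C[1+k]≡[1+2k]Ck : ∀ k → suc (2 * k) C suc k ≡ [1+2k]Ck k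
  [1+2k]C[1+k]≡[1+2k]Ck k = begin
    suc (2 * k) C suc k               ≡⟨ nCk≡nC[n∸k] (s≤s (ℕ.m≤m+n k (k + 0))) ⟩
    suc (2 * k) C (k + (k + 0) ∸ k)   ≡⟨ cong (suc (2 * k) C_) (trans (ℕ.m+n∸m≡n k (k + 0)) (ℕ.+-identityʳ k)) ⟩
    suc (2 * k) C k                   ∎

  [1+2k]*[2k]Ck≡[1+k]*[1+2k]Ck : ∀ k → (2 * k + 1) * (2 * k C k) ≡ suc k * [1+2k]Ck k
  [1+2k]*[2k]Ck≡[1+k]*[1+2k]Ck k = begin
    (2 * k + 1) * (2 * k C k)         ≡⟨ cong (_* (2 * k C k)) (ℕ.+-comm (2 * k) 1) ⟩
    suc (2 * k) * (2 * k C k)         ≡⟨ [1+k]*[1+n]C[1+k]≡[1+n]*nCk (2 * k) k ⟨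
    suc k * (suc (2 * k) C suc k)     ≡⟨ cong (suc k *_) ([1+2k]C[1+k]≡[1+2k]Ck k) ⟩
    suc k * [1+2k]Ck k                ∎

  [2+2k]C[1+k]≡2*[1+2k]Ck : ∀ k → 2 * suc k C suc k ≡ 2 * [1+2k]Ck k
  [2+2k]C[1+k]≡2*[1+2k]Ck k = begin
    2 * suc k C suc k                          ≡⟨ cong (_C suc k) (ℕ.*-distribˡ-+ 2 1 k) ⟩
    suc (suc (2 * k)) C suc k                  ≡⟨ nCk+nC[k+1]≡[n+1]C[k+1] (suc (2 * k)) k ⟨
    [1+2k]Ck k + suc (2 * k) C suc k           ≡⟨ cong ([1+2k]Ck k +_) ([1+2k]C[1+k]≡[1+2k]Ck k) ⟩
    [1+2k]Ck k + [1+2k]Ck k                    ≡⟨ cong ([1+2k]Ck k +_) (ℕ.+-identityʳ _) ⟨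
    2 * [1+2k]Ck k                             ∎

  X : ℕ → ℕ → ℕ
  X n k = (2 * k + 1) * (2 * k C k) * ((n C k) * (n C k))

  S[1+s]≡ΣX : ∀ s n → S n (suc s) ≡ sumBelow (suc n) (λ k → oddPower s k * X n k)
  S[1+s]≡ΣX s n = trans (sumTo≡sumBelow n _) (sumBelow-cong (suc n) λ k →
    reorder (n C k) (2 * k C k) (2 * k + 1) ((2 * k + 1) ^ s))
    where
    reorder : ∀ b c o p → b * b * c * (o * p) ≡ p * (o * c * (b * b))
    reorder = solve-∀

module _ where

  open import Data.Integer using (ℤ; +_; 0ℤ; _+_; _-_; _*_)
  open import Data.Integer.Divisibility.Signed using (_∣_; divides; ∣m∣n⇒∣m+n; ∣n⇒∣m*n; ∣ᵤ⇒∣)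
  open import Data.Integer.Tactic.RingSolver using (solve-∀)
  open import Algebra.Properties.CommutativeSemigroup ℤ.+-commutativeSemigroup using (interchange)

  sumBelowℤ : ℕ → (ℕ → ℤ) → ℤ
  sumBelowℤ zero    f = 0ℤ
  sumBelowℤ (suc m) f = sumBelowℤ m f + f m

  sumBelowℤ-cong : ∀ m {f g : ℕ → ℤ} → (∀ i → f i ≡ g i) → sumBelowℤ m f ≡ sumBelowℤ m g
  sumBelowℤ-cong zero    f≗g = refl
  sumBelowℤ-cong (suc m) f≗g = cong₂ _+_ (sumBelowℤ-cong m f≗g) (f≗g m)

  sumBelowℤ-+ : ∀ m (f g : ℕ → ℤ) → sumBelowℤ m (λ i → f i + g i) ≡ sumBelowℤ m f + sumBelowℤ m g
  sumBelowℤ-+ zero    f g = refl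
  sumBelowℤ-+ (suc m) f g = begin
    sumBelowℤ m (λ i → f i + g i) + (f m + g m)   ≡⟨ cong (_+ (f m + g m)) (sumBelowℤ-+ m f g) ⟩
    sumBelowℤ m f + sumBelowℤ m g + (f m + g m)   ≡⟨ interchange (sumBelowℤ m f) (sumBelowℤ m g) (f m) (g m) ⟩
    sumBelowℤ m f + f m + (sumBelowℤ m g + g m)   ∎

  pos-sumBelow : ∀ m (f : ℕ → ℕ) → + sumBelow m f ≡ sumBelowℤ m (λ i → + f i)
  pos-sumBelow zero    f = refl
  pos-sumBelow (suc m) f = trans (ℤ.pos-+ (sumBelow m f) (f m)) (cong (_+ + f m) (pos-sumBelow m f))

  ∣-sumBelowℤ : ∀ {d} m {f : ℕ → ℤ} → (∀ i → d ∣ f i) → d ∣ sumBelowℤ m f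
  ∣-sumBelowℤ zero    d∣f = divides 0ℤ refl
  ∣-sumBelowℤ (suc m) d∣f = ∣m∣n⇒∣m+n (∣-sumBelowℤ m d∣f) (d∣f m)

  sumBelowℤ-byParts : ∀ m (f g : ℕ → ℤ) →
    sumBelowℤ m (λ k → sumBelowℤ (suc k) f * (g k - g (suc k)))
      ≡ sumBelowℤ m (λ k → f k * g k) - sumBelowℤ m f * g m
  sumBelowℤ-byParts zero    f g = refl
  sumBelowℤ-byParts (suc m) f g = begin
    sumBelowℤ m (λ k → sumBelowℤ (suc k) f * (g k - g (suc k))) + (F + f m) * (g m - g (suc m))
      ≡⟨ cong (_+ (F + f m) * (g m - g (suc m))) (sumBelowℤ-byParts m f g) ⟩
    (sumBelowℤ m (λ k → f k * g k) - F * g m) + (F + f m) * (g m - g (suc m))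
      ≡⟨ rearrange (sumBelowℤ m (λ k → f k * g k)) F (f m) (g m) (g (suc m)) ⟩
    (sumBelowℤ m (λ k → f k * g k) + f m * g m) - (F + f m) * g (suc m)
      ∎
    where
    F = sumBelowℤ m f
    rearrange : ∀ Σfg F fm gm gm' → (Σfg - F * gm) + (F + fm) * (gm - gm') ≡ (Σfg + fm * gm) - (F + fm) * gm'
    rearrange = solve-∀

  sumBelowℤ-lastZero : ∀ m {g : ℕ → ℤ} → g m ≡ 0ℤ → sumBelowℤ (suc m) g ≡ sumBelowℤ m g
  sumBelowℤ-lastZero m {g} gm≡0 = trans (cong (λ t → sumBelowℤ m g + t) gm≡0) (ℤ.+-identityʳ (sumBelowℤ m g))

  i-j≡k*[u-v]⇒i≡j : ∀ {i j u v} k → u ≡ v → i - j ≡ k * (u - v) → i ≡ j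
  i-j≡k*[u-v]⇒i≡j {i} {j} k u≡v eq =
    ℤ.i-j≡0⇒i≡j i j (trans eq (trans (cong (k *_) (ℤ.i≡j⇒i-j≡0 u≡v)) (ℤ.*-zeroʳ k)))

  T : ℕ → ℕ → ℤ
  T n k = + (n C suc k) * + (n C suc k) * + [1+2k]Ck k * (+ 3 * + suc k - + 2 * + n)

  pos-x*y*[z*z] : ∀ x y z → + (x ℕ.* y ℕ.* (z ℕ.* z)) ≡ + x * + y * (+ z * + z)
  pos-x*y*[z*z] x y z = trans (ℤ.pos-* (x ℕ.* y) _) (cong₂ _*_ (ℤ.pos-* x y) (ℤ.pos-* z z))

  +X[n,k]≡[1+k]*[1+2k]Ck*nCk² : ∀ n k → + X n k ≡ + suc k * + [1+2k]Ck k * (+ (n C k) * + (n C k))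
  +X[n,k]≡[1+k]*[1+2k]Ck*nCk² n k = trans (cong (λ c → + (c ℕ.* ((n C k) ℕ.* (n C k)))) ([1+2k]*[2k]Ck≡[1+k]*[1+2k]Ck k))
                  (pos-x*y*[z*z] (suc k) ([1+2k]Ck k) (n C k))

  +X[n,1+k]≡[3+2k]*2[1+2k]Ck*nC[1+k]² : ∀ n k → + X n (suc k) ≡ (+ 2 * + suc k + + 1) * (+ 2 * + [1+2k]Ck k) * (+ (n C suc k) * + (n C suc k))
  +X[n,1+k]≡[3+2k]*2[1+2k]Ck*nC[1+k]² n k = begin
    + X n (suc k)
      ≡⟨ cong (λ c → + ((2 ℕ.* suc k ℕ.+ 1) ℕ.* c ℕ.* ((n C suc k) ℕ.* (n C suc k)))) ([2+2k]C[1+k]≡2*[1+2k]Ck k) ⟩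
    + ((2 ℕ.* suc k ℕ.+ 1) ℕ.* (2 ℕ.* [1+2k]Ck k) ℕ.* ((n C suc k) ℕ.* (n C suc k)))
      ≡⟨ pos-x*y*[z*z] (2 ℕ.* suc k ℕ.+ 1) (2 ℕ.* [1+2k]Ck k) (n C suc k) ⟩
    + (2 ℕ.* suc k ℕ.+ 1) * + (2 ℕ.* [1+2k]Ck k) * (+ (n C suc k) * + (n C suc k))
      ≡⟨ cong₂ (λ o c → o * c * (+ (n C suc k) * + (n C suc k)))
               (trans (ℤ.pos-+ (2 ℕ.* suc k) 1) (cong (_+ + 1) (ℤ.pos-* 2 (suc k)))) (ℤ.pos-* 2 ([1+2k]Ck k)) ⟩
    (+ 2 * + suc k + + 1) * (+ 2 * + [1+2k]Ck k) * (+ (n C suc k) * + (n C suc k))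
      ∎

  pascalℤ : ∀ n k → + (suc n C suc k) ≡ + (n C k) + + (n C suc k)
  pascalℤ n k = trans (cong +_ (sym (nCk+nC[k+1]≡[n+1]C[k+1] n k))) (ℤ.pos-+ (n C k) (n C suc k))

  absorptionℤ : ∀ n k → + suc k * + (suc n C suc k) ≡ + suc n * + (n C k)
  absorptionℤ n k = begin
    + suc k * + (suc n C suc k)       ≡⟨ ℤ.pos-* (suc k) _ ⟨
    + (suc k ℕ.* (suc n C suc k))     ≡⟨ cong +_ ([1+k]*[1+n]C[1+k]≡[1+n]*nCk n k) ⟩
    + (suc n ℕ.* (n C k))             ≡⟨ ℤ.pos-* (suc n) (n C k) ⟩
    + suc n * + (n C k)               ∎

  telescoping-algebra : ∀ a b c k n → k * (b + a) ≡ (+ 1 + n) * b →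
    (b + a) * (b + a) * c * (+ 3 * k - + 2 * (+ 1 + n))
      ≡ a * a * c * (+ 3 * k - + 2 * n) + (k * c * (b * b) - (+ 2 * k + + 1) * (+ 2 * c) * (a * a))
  telescoping-algebra a b c k n hyp = i-j≡k*[u-v]⇒i≡j (c * (+ 4 * a + + 2 * b)) hyp (difference a b c k n)
    where
    difference : ∀ a b c k n →
      (b + a) * (b + a) * c * (+ 3 * k - + 2 * (+ 1 + n))
        - (a * a * c * (+ 3 * k - + 2 * n) + (k * c * (b * b) - (+ 2 * k + + 1) * (+ 2 * c) * (a * a)))
      ≡ c * (+ 4 * a + + 2 * b) * (k * (b + a) - (+ 1 + n) * b)
    difference = solve-∀

  T[1+n,k]≡T[n,k]+X[n,k]-X[n,1+k] : ∀ n k → T (suc n) k ≡ T n k + (+ X n k - + X n (suc k))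
  T[1+n,k]≡T[n,k]+X[n,k]-X[n,1+k] n k = begin
    T (suc n) k
      ≡⟨ cong₂ (λ a' m → a' * a' * c * (+ 3 * k' - + 2 * m)) (pascalℤ n k) (ℤ.pos-+ 1 n) ⟩
    (b + a) * (b + a) * c * (+ 3 * k' - + 2 * (+ 1 + + n))
      ≡⟨ telescoping-algebra a b c k' (+ n) absorption ⟩
    T n k + (k' * c * (b * b) - (+ 2 * k' + + 1) * (+ 2 * c) * (a * a))
      ≡⟨ cong₂ (λ x x' → T n k + (x - x')) (+X[n,k]≡[1+k]*[1+2k]Ck*nCk² n k) (+X[n,1+k]≡[3+2k]*2[1+2k]Ck*nC[1+k]² n k) ⟨
    T n k + (+ X n k - + X n (suc k))
      ∎
    where
    a = + (n C suc k)
    b = + (n C k)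
    c = + [1+2k]Ck k
    k' = + suc k
    absorption : k' * (b + a) ≡ (+ 1 + + n) * b
    absorption = trans (cong (k' *_) (sym (pascalℤ n k))) (absorptionℤ n k)

  oddPowerSumℤ : ℕ → ℕ → ℤ
  oddPowerSumℤ s m = sumBelowℤ m (λ i → + oddPower s i)

  +S[1+s]≡ΣX : ∀ s n → + S n (suc s) ≡ sumBelowℤ (suc n) (λ k → + oddPower s k * + X n k)
  +S[1+s]≡ΣX s n = begin
    + S n (suc s)                                               ≡⟨ cong +_ (S[1+s]≡ΣX s n) ⟩
    + sumBelow (suc n) (λ k → oddPower s k ℕ.* X n k)           ≡⟨ pos-sumBelow (suc n) _ ⟩
    sumBelowℤ (suc n) (λ k → + (oddPower s k ℕ.* X n k))        ≡⟨ sumBelowℤ-cong (suc n) (λ k → ℤ.pos-* (oddPower s k) (X n k)) ⟩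
    sumBelowℤ (suc n) (λ k → + oddPower s k * + X n k)          ∎

  T[n,n]≡0 : ∀ n → T n n ≡ 0ℤ
  T[n,n]≡0 n rewrite k>n⇒nCk≡0 (ℕ.n<1+n n) = refl

  X[n,1+n]≡0 : ∀ n → X n (suc n) ≡ 0
  X[n,1+n]≡0 n rewrite k>n⇒nCk≡0 (ℕ.n<1+n n) = ℕ.*-zeroʳ ((2 ℕ.* suc n ℕ.+ 1) ℕ.* (2 ℕ.* suc n C suc n))

  ΣS≡ΣOT : ∀ s n → + sumBelow n (λ j → S j (suc s)) ≡ sumBelowℤ n (λ k → oddPowerSumℤ s (suc k) * T n k)
  ΣS≡ΣOT s zero    = refl
  ΣS≡ΣOT s (suc n) = begin
    + (sumBelow n (λ j → S j (suc s)) ℕ.+ S n (suc s))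
      ≡⟨ ℤ.pos-+ (sumBelow n (λ j → S j (suc s))) (S n (suc s)) ⟩
    + sumBelow n (λ j → S j (suc s)) + + S n (suc s)
      ≡⟨ cong₂ _+_ (ΣS≡ΣOT s n) (+S[1+s]≡ΣX s n) ⟩
    sumBelowℤ n (λ k → O k * T n k) + sumBelowℤ (suc n) (λ k → o k * x k)
      ≡⟨ cong₂ _+_ dropLastTerm abelSummation ⟨
    sumBelowℤ (suc n) (λ k → O k * T n k) + sumBelowℤ (suc n) (λ k → O k * (x k - x (suc k)))
      ≡⟨ sumBelowℤ-+ (suc n) _ _ ⟨
    sumBelowℤ (suc n) (λ k → O k * T n k + O k * (x k - x (suc k)))
      ≡⟨ sumBelowℤ-cong (suc n) (λ k → trans (sym (ℤ.*-distribˡ-+ (O k) _ _)) (cong (O k *_) (sym (T[1+n,k]≡T[n,k]+X[n,k]-X[n,1+k] n k)))) ⟩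
    sumBelowℤ (suc n) (λ k → O k * T (suc n) k)
      ∎
    where
    O = λ k → oddPowerSumℤ s (suc k)
    o = λ k → + oddPower s k
    x = λ k → + X n k
    dropLastTerm : sumBelowℤ (suc n) (λ k → O k * T n k) ≡ sumBelowℤ n (λ k → O k * T n k)
    dropLastTerm = sumBelowℤ-lastZero n (trans (cong (O n *_) (T[n,n]≡0 n)) (ℤ.*-zeroʳ (O n)))
    abelSummation : sumBelowℤ (suc n) (λ k → O k * (x k - x (suc k))) ≡ sumBelowℤ (suc n) (λ k → o k * x k)
    abelSummation = begin
      sumBelowℤ (suc n) (λ k → O k * (x k - x (suc k)))   ≡⟨ sumBelowℤ-byParts (suc n) o x ⟩
      Σox - O n * x (suc n)                               ≡⟨ cong (λ t → Σox - O n * + t) (X[n,1+n]≡0 n) ⟩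
      Σox - O n * 0ℤ                                      ≡⟨ cong (λ t → Σox - t) (ℤ.*-zeroʳ (O n)) ⟩
      Σox - 0ℤ                                            ≡⟨ ℤ.+-identityʳ Σox ⟩
      Σox                                                 ∎
      where Σox = sumBelowℤ (suc n) (λ k → o k * x k)

  [1+n]²∣[1+k]*T[1+n,k] : ∀ n k → + suc n * + suc n ∣ + suc k * T (suc n) k
  [1+n]²∣[1+k]*T[1+n,k] n k = divides (c * b * (+ 3 * b - + 2 * a))
    (i-j≡k*[u-v]⇒i≡j (c * (+ 3 * (k' * a + N * b) - + 2 * N * a)) (absorptionℤ n k) (difference a b c k' N))
    where
    a = + (suc n C suc k)
    b = + (n C k)
    c = + [1+2k]Ck k
    k' = + suc k
    N = + suc n
    difference : ∀ a b c k N →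
      k * (a * a * c * (+ 3 * k - + 2 * N)) - c * b * (+ 3 * b - + 2 * a) * (N * N)
        ≡ c * (+ 3 * (k * a + N * b) - + 2 * N * a) * (k * a - N * b)
    difference = solve-∀

  n²∣ΣOT : ∀ s n → (∀ m → m ℕ.∣ oddPowerSum s m) → + n * + n ∣ sumBelowℤ n (λ k → oddPowerSumℤ s (suc k) * T n k)
  n²∣ΣOT s zero    m∣O = divides 0ℤ refl
  n²∣ΣOT s (suc n) m∣O = ∣-sumBelowℤ (suc n) n²∣O*T
    where
    n²∣O*T : ∀ k → + suc n * + suc n ∣ oddPowerSumℤ s (suc k) * T (suc n) k
    n²∣O*T k with ∣ᵤ⇒∣ {+ suc k} {+ oddPowerSum s (suc k)} (m∣O (suc k))
    ... | divides q O≡q*[1+k] = subst (_ ∣_) (sym (begin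
      oddPowerSumℤ s (suc k) * T (suc n) k   ≡⟨ cong (_* T (suc n) k) (trans (sym (pos-sumBelow (suc k) (oddPower s))) O≡q*[1+k]) ⟩
      q * + suc k * T (suc n) k              ≡⟨ ℤ.*-assoc q (+ suc k) (T (suc n) k) ⟩
      q * (+ suc k * T (suc n) k)            ∎))
      (∣n⇒∣m*n q ([1+n]²∣[1+k]*T[1+n,k] n k))

  n²∣ΣS : ∀ s n → (∀ m → m ℕ.∣ oddPowerSum s m) → + (n ℕ.* n) ∣ + sumBelow n (λ j → S j (suc s))
  n²∣ΣS s n m∣O = subst₂ _∣_ (sym (ℤ.pos-* n n)) (sym (ΣS≡ΣOT s n)) (n²∣ΣOT s n m∣O)

open import Data.Nat using (_+_; _*_; _^_)
open import Data.Nat.Divisibility using (_∣_)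
open import Data.Integer using (+_)
open import Data.Integer.Divisibility.Signed using (∣⇒∣ᵤ)

theorem1p1 : (n r : ℕ) → .{{_ : NonZero n}} → .{{_ : NonZero r}} →
    n ^ 2 ∣ sumBelow n (λ k → S k (2 * r))
theorem1p1 n zero    = ⊥-elim (≢-nonZero⁻¹ 0 refl)
theorem1p1 n (suc r) = subst₂ _∣_ n*n≡n^2 (cong (λ e → sumBelow n (λ k → S k e)) 2+2r≡2*[1+r])
  (∣⇒∣ᵤ {+ (n * n)} {+ sumBelow n (λ k → S k (2 + 2 * r))} (n²∣ΣS (1 + 2 * r) n (m∣oddPowerSum[1+2t] r)))
  where
  n*n≡n^2 : n * n ≡ n ^ 2
  n*n≡n^2 = cong (n *_) (sym (ℕ.*-identityʳ n))
  2+2r≡2*[1+r] : 2 + 2 * r ≡ 2 * suc r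
  2+2r≡2*[1+r] = sym (ℕ.*-distribˡ-+ 2 1 r)
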